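{- Let $T$ be a tree having a perfect matching, and let $T'$ be a tree obtained from $T$ by attaching at least two new leaves (pendant vertices) to each vertex of $T$. Then $T'$ has no $pc$-partition.
   Context: A paired dominating set of $G$ is a dominating set $S$ such that $G[S]$ has a perfect matching. Two disjoint sets form a paired coalition if neither is a paired dominating set but their union is. A $pc$-partition of $G$ is a partition of $V(G)$ into nonempty sets, none a paired dominating set, each forming a paired coalition with some other set of the partition. -}

module Defs where

open import Level using (0ℓ)
open import Data.Nat using (ℕ; _≤_)
open import Data.Fin using (Fin)
open import Data.List using (List; _∷_; []; _∷ʳ_; length)
open import Data.List.Relation.Unary.Linked using (Linked)
open import Data.List.Relation.Unary.Unique.Propositional using (Unique)
open import Data.Product using (Σ; ∃; _×_; _,_)
open import Data.Sum using (_⊎_)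
open import Data.Empty using (⊥)
open import Data.Unit using (⊤)
open import Relation.Nullary using (¬_)
open import Relation.Binary.PropositionalEquality using (_≡_; _≢_)

record Graph (n : ℕ) : Set₁ where
  field
    Adj    : Fin n → Fin n → Set
    sym    : ∀ {u v} → Adj u v → Adj v u
    irrefl : ∀ {u} → ¬ Adj u u
open Graph public

VSet : ℕ → Set₁
VSet n = Fin n → Set

module _ {n : ℕ} (G : Graph n) where

  data Walk : Fin n → Fin n → Set where
    here : ∀ {u} → Walk u u
    step : ∀ {u w v} → Adj G u w → Walk w v → Walk u v

  Connected : Set
  Connected = 1 ≤ n × (∀ u v → Walk u v)

  IsCycle : Fin n → List (Fin n) → Set
  IsCycle x ys = 2 ≤ length ys × Unique (x ∷ ys) × Linked (Adj G) ((x ∷ ys) ∷ʳ x)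

  Acyclic : Set
  Acyclic = ∀ x ys → ¬ IsCycle x ys

  IsTree : Set
  IsTree = Connected × Acyclic

  HasPerfectMatchingOn : VSet n → Set
  HasPerfectMatchingOn S =
    Σ (Fin n → Fin n) λ m →
      ∀ v → S v → S (m v) × Adj G v (m v) × m (m v) ≡ v

  HasPerfectMatching : Set
  HasPerfectMatching = HasPerfectMatchingOn (λ _ → ⊤)

  IsDominating : VSet n → Set
  IsDominating S = ∀ v → S v ⊎ (∃ λ u → S u × Adj G u v)

  IsPairedDominating : VSet n → Set
  IsPairedDominating S = IsDominating S × HasPerfectMatchingOn S

  _∪_ : VSet n → VSet n → VSet n
  (A ∪ B) v = A v ⊎ B v

  Disjoint : VSet n → VSet n → Set
  Disjoint A B = ∀ v → A v → B v → ⊥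

  IsPairedCoalition : VSet n → VSet n → Set
  IsPairedCoalition A B =
    Disjoint A B × ¬ IsPairedDominating A × ¬ IsPairedDominating B
      × IsPairedDominating (A ∪ B)

  -- A partition of V(G) into k nonempty sets, given by a class map onto Fin k.
  Class : ∀ {k} → (Fin n → Fin k) → Fin k → VSet n
  Class c i v = c v ≡ i

  IsPCPartition : (k : ℕ) → (Fin n → Fin k) → Set
  IsPCPartition k c =
    (∀ i → ∃ λ v → c v ≡ i)
    × (∀ i → ¬ IsPairedDominating (Class c i))
    × (∀ i → ∃ λ j → j ≢ i × IsPairedCoalition (Class c i) (Class c j))

  HasPCPartition : Set
  HasPCPartition = ∃ λ k → ∃ λ (c : Fin n → Fin k) → IsPCPartition k c

-- The map emb identifies
-- V(G) with a subset of V(G'); every other vertex of G' is a new leaf whose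
-- unique neighbour is emb (parent w).
IsNew : ∀ {n m} → (Fin n → Fin m) → Fin m → Set
IsNew emb w = ∀ v → emb v ≢ w

AttachLeaves≥2 : ∀ {n m} → Graph n → Graph m → Set
AttachLeaves≥2 {n} {m} G G' =
  Σ (Fin n → Fin m) λ emb →
  Σ (Fin m → Fin n) λ parent →
    (∀ u v → emb u ≡ emb v → u ≡ v)
    × (∀ u v → (Adj G' (emb u) (emb v) → Adj G u v) × (Adj G u v → Adj G' (emb u) (emb v)))
    × (∀ w → IsNew emb w → ∀ y → (Adj G' w y → y ≡ emb (parent w)) × (y ≡ emb (parent w) → Adj G' w y))
    × (∀ v → ∃ λ w₁ → ∃ λ w₂ → w₁ ≢ w₂ × IsNew emb w₁ × IsNew emb w₂
              × parent w₁ ≡ v × parent w₂ ≡ v)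

{-# OPTIONS --safe #-}
module Submission where

-- Every paired dominating set of T' contains V(T) (a leaf is dominated, or
-- matched, only through its parent) and never contains two sibling leaves
-- (both would be matched to their common parent).  So in a pc-partition each
-- coalition contains V(T), and a class missing a vertex x of T must be
-- partnered with the class of x.  It follows that sibling leaves lie in
-- distinct classes, no leaf lies in its parent's class, and all of V(T) lies
-- in one class.  That class is then exactly V(T), which is paired dominating
-- by the perfect matching of T.

open import Defs hiding (sym)
open import Data.Nat using (zero; suc)
open import Data.Fin using (Fin; zero)
open import Data.Fin.Properties using (any?; _≟_)
open import Data.Product using (∃; _×_; _,_; proj₁; proj₂)
open import Data.Sum using (inj₁; inj₂)
open import Data.Empty using (⊥; ⊥-elim)
open import Data.Unit using (tt)
open import Function using (_∘_)
open import Relation.Nullary using (¬_; yes; no)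
open import Relation.Nullary.Decidable using (decidable-stable)
open import Relation.Binary.PropositionalEquality
  using (_≡_; _≢_; refl; sym; trans; cong; subst; module ≡-Reasoning)

matchedPartner-injective : ∀ {n} (G : Graph n) {S : VSet n} →
  ((μ , _) : HasPerfectMatchingOn G S) → ∀ {x y} → S x → S y → μ x ≡ μ y → x ≡ y
matchedPartner-injective G (μ , matched) {x} {y} x∈S y∈S μx≡μy = begin
  x        ≡⟨ sym (proj₂ (proj₂ (matched x x∈S))) ⟩
  μ (μ x)  ≡⟨ cong μ μx≡μy ⟩
  μ (μ y)  ≡⟨ proj₂ (proj₂ (matched y y∈S)) ⟩
  y        ∎
  where open ≡-Reasoning

module AttachedLeaves {n m} (T : Graph n) (T' : Graph m)
  (emb : Fin n → Fin m) (parent : Fin m → Fin n)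
  (emb-injective : ∀ u v → emb u ≡ emb v → u ≡ v)
  (emb-adj : ∀ u v → (Adj T' (emb u) (emb v) → Adj T u v) × (Adj T u v → Adj T' (emb u) (emb v)))
  (leaf-adj : ∀ w → IsNew emb w → ∀ y → (Adj T' w y → y ≡ emb (parent w)) × (y ≡ emb (parent w) → Adj T' w y))
  (two-leaves : ∀ v → ∃ λ w₁ → ∃ λ w₂ → w₁ ≢ w₂ × IsNew emb w₁ × IsNew emb w₂
                  × parent w₁ ≡ v × parent w₂ ≡ v)
  where

  Siblings : Fin m → Fin m → Set
  Siblings w₁ w₂ = w₁ ≢ w₂ × IsNew emb w₁ × IsNew emb w₂ × parent w₁ ≡ parent w₂

  sibling : ∀ {w} → IsNew emb w → ∃ λ w′ → Siblings w w′
  sibling {w} new with two-leaves (parent w)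
  ... | w₁ , w₂ , w₁≢w₂ , new₁ , new₂ , p₁ , p₂ with w₁ ≟ w
  ...   | yes refl = w₂ , w₁≢w₂ , new , new₂ , sym p₂
  ...   | no w₁≢w  = w₁ , w₁≢w ∘ sym , new , new₁ , sym p₁

  leaf-neighbour : ∀ {w y} → IsNew emb w → Adj T' w y → y ≡ emb (parent w)
  leaf-neighbour {w} {y} new = proj₁ (leaf-adj w new y)

  pairedDom⇒parent∈ : ∀ {S w} → IsPairedDominating T' S → IsNew emb w → S (emb (parent w))
  pairedDom⇒parent∈ {S} {w} (dominating , _ , matched) new with dominating w
  ... | inj₁ w∈S = subst S (leaf-neighbour new (proj₁ (proj₂ (matched w w∈S)))) (proj₁ (matched w w∈S))
  ... | inj₂ (u , u∈S , u~w) = subst S (leaf-neighbour new (Graph.sym T' u~w)) u∈S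

  pairedDom⇒emb∈ : ∀ {S} → IsPairedDominating T' S → ∀ v → S (emb v)
  pairedDom⇒emb∈ pd v with two-leaves v
  ... | w , _ , _ , new , _ , refl , _ = pairedDom⇒parent∈ pd new

  pairedDom⇒¬siblings : ∀ {S w₁ w₂} → IsPairedDominating T' S → Siblings w₁ w₂ → S w₁ → S w₂ → ⊥
  pairedDom⇒¬siblings {w₁ = w₁} {w₂} (_ , matching@(μ , matched))
                      (w₁≢w₂ , new₁ , new₂ , p₁≡p₂) w₁∈S w₂∈S =
    w₁≢w₂ (matchedPartner-injective T' matching w₁∈S w₂∈S (begin
      μ w₁               ≡⟨ leaf-neighbour new₁ (proj₁ (proj₂ (matched w₁ w₁∈S))) ⟩
      emb (parent w₁)    ≡⟨ cong emb p₁≡p₂ ⟩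
      emb (parent w₂)    ≡⟨ sym (leaf-neighbour new₂ (proj₁ (proj₂ (matched w₂ w₂∈S)))) ⟩
      μ w₂               ∎))
    where open ≡-Reasoning

  extendFromImage : (Fin n → Fin n) → Fin m → Fin m
  extendFromImage f w with any? (λ v → emb v ≟ w)
  ... | yes (v , _) = emb (f v)
  ... | no _        = w

  extendFromImage-emb : ∀ f u → extendFromImage f (emb u) ≡ emb (f u)
  extendFromImage-emb f u with any? (λ v → emb v ≟ emb u)
  ... | yes (v , e) = cong (emb ∘ f) (emb-injective v u e)
  ... | no ∄v       = ⊥-elim (∄v (u , refl))

  image-pairedDom : ∀ {S} → HasPerfectMatching T → (∀ v → S (emb v)) → (∀ w → IsNew emb w → ¬ S w) →
                    IsPairedDominating T' S
  image-pairedDom {S} (μT , matchedT) emb∈S leaf∉S = dominating , extendFromImage μT , matched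
    where
    dominating : IsDominating T' S
    dominating w with any? (λ v → emb v ≟ w)
    ... | yes (v , refl) = inj₁ (emb∈S v)
    ... | no ∄v = inj₂ (emb (parent w) , emb∈S (parent w) ,
                        Graph.sym T' (proj₂ (leaf-adj w (λ v e → ∄v (v , e)) _) refl))

    matched : ∀ w → S w → S (extendFromImage μT w) × Adj T' w (extendFromImage μT w)
                            × extendFromImage μT (extendFromImage μT w) ≡ w
    matched w w∈S with any? (λ v → emb v ≟ w)
    ... | no ∄v = ⊥-elim (leaf∉S w (λ v e → ∄v (v , e)) w∈S)
    ... | yes (v , refl) =
      emb∈S (μT v) ,
      proj₂ (emb-adj v (μT v)) (proj₁ (proj₂ (matchedT v tt))) ,
      trans (extendFromImage-emb μT (μT v)) (cong emb (proj₂ (proj₂ (matchedT v tt))))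

  module PCPartition {k} (c : Fin m → Fin k)
    (coalitions : ∀ i → ∃ λ j → j ≢ i × IsPairedCoalition T' (Class T' c i) (Class T' c j))
    where

    partner : Fin k → Fin k
    partner i = proj₁ (coalitions i)

    Coalition : Fin k → VSet m
    Coalition i = _∪_ T' (Class T' c i) (Class T' c (partner i))

    coalition-pairedDom : ∀ i → IsPairedDominating T' (Coalition i)
    coalition-pairedDom i = proj₂ (proj₂ (proj₂ (proj₂ (proj₂ (coalitions i)))))

    partner≡class-of-emb : ∀ {i v} → c (emb v) ≢ i → partner i ≡ c (emb v)
    partner≡class-of-emb {i} {v} cv≢i with pairedDom⇒emb∈ (coalition-pairedDom i) v
    ... | inj₁ cv≡i        = ⊥-elim (cv≢i cv≡i)
    ... | inj₂ cv≡partner = sym cv≡partner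

    siblings-class-≢ : ∀ {w₁ w₂} → Siblings w₁ w₂ → c w₁ ≢ c w₂
    siblings-class-≢ {w₁} siblings c₁≡c₂ =
      pairedDom⇒¬siblings (coalition-pairedDom (c w₁)) siblings (inj₁ refl) (inj₁ (sym c₁≡c₂))

    leaf-class-≢-parent-class : ∀ {w} → IsNew emb w → c w ≢ c (emb (parent w))
    leaf-class-≢-parent-class {w} new cw≡cp with sibling new
    ... | w′ , siblings =
      pairedDom⇒¬siblings (coalition-pairedDom (c w′)) siblings (inj₂ w∈partner) (inj₁ refl)
      where
      cp≢cw′ : c (emb (parent w)) ≢ c w′
      cp≢cw′ cp≡cw′ = siblings-class-≢ siblings (trans cw≡cp cp≡cw′)

      w∈partner : c w ≡ partner (c w′)
      w∈partner = trans cw≡cp (sym (partner≡class-of-emb cp≢cw′))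

    -- If two vertices of T had distinct classes a ≠ b, both leaves of the first
    -- would avoid a, so their classes are partnered with a and must then be b:
    -- two siblings in one class.
    emb-class-constant : ∀ u v → c (emb u) ≡ c (emb v)
    emb-class-constant u v = decidable-stable (c (emb u) ≟ c (emb v)) λ cu≢cv →
      let w₁ , w₂ , w₁≢w₂ , new₁ , new₂ , p₁ , p₂ = two-leaves u
      in siblings-class-≢ (w₁≢w₂ , new₁ , new₂ , trans p₁ (sym p₂))
           (trans (leaf-class≡ cu≢cv new₁ p₁) (sym (leaf-class≡ cu≢cv new₂ p₂)))
      where
      leaf-class≡ : c (emb u) ≢ c (emb v) → ∀ {w} → IsNew emb w → parent w ≡ u → c w ≡ c (emb v)
      leaf-class≡ cu≢cv {w} new pw≡u with pairedDom⇒emb∈ (coalition-pairedDom (c w)) v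
      ... | inj₁ cv≡cw       = sym cv≡cw
      ... | inj₂ cv≡partner = ⊥-elim (cu≢cv (sym (trans cv≡partner (partner≡class-of-emb cu≢cw))))
        where
        cu≢cw : c (emb u) ≢ c w
        cu≢cw cu≡cw = leaf-class-≢-parent-class new
                        (trans (sym cu≡cw) (cong (c ∘ emb) (sym pw≡u)))

    class-of-emb-pairedDom : HasPerfectMatching T → ∀ r → IsPairedDominating T' (Class T' c (c (emb r)))
    class-of-emb-pairedDom matchingT r =
      image-pairedDom matchingT (λ v → emb-class-constant v r)
        (λ w new cw≡cr → leaf-class-≢-parent-class new (trans cw≡cr (emb-class-constant r (parent w))))

  ¬pcPartition : HasPerfectMatching T → Fin n → ¬ HasPCPartition T'
  ¬pcPartition matchingT r (_ , c , _ , classes-not-pairedDom , coalitions) =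
    classes-not-pairedDom (c (emb r)) (class-of-emb-pairedDom matchingT r)
    where open PCPartition c coalitions

mainTheorem7 : ∀ {n m} (T : Graph n) (T' : Graph m)
    → IsTree T → HasPerfectMatching T → AttachLeaves≥2 T T'
    → ¬ HasPCPartition T'
mainTheorem7 {zero} T T' ((() , _) , _) _ _ _
mainTheorem7 {suc n} T T' _ matchingT (emb , parent , emb-injective , emb-adj , leaf-adj , two-leaves) =
  AttachedLeaves.¬pcPartition T T' emb parent emb-injective emb-adj leaf-adj two-leaves matchingT zero
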